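{- Let $\mathcal{T}$ be the groupoid with a single object $\mathsf{tt}$ whose morphisms $\mathsf{tt}\to\mathsf{tt}$ are $\mathbb{Z}\times\mathbb{Z}$ (composition is componentwise addition), equipped with the algebra structure for the torus signature whose point constructor is $\mathsf{tt}$, whose two path constructors are the natural transformations with components $(1,0)$ and $(0,1)$, and whose homotopy constructor holds since $(1,0)+(0,1)=(0,1)+(1,0)$. Then $\mathcal{T}$ is biinitial in $\mathrm{AlgG}(\mathcal{T}^2)$.
   Context: The torus signature $\mathcal{T}^2$ has point-constructor code $C_{\mathbf 1}$; two path constructors (indexed by the booleans) with argument code $C_{\mathbf 1}$ and both endpoints $\mathsf{constr}$; and one homotopy constructor with no point or path arguments, whose two sides are $\mathsf{path}(\mathsf{true})\bullet\mathsf{path}(\mathsf{false})$ and $\mathsf{path}(\mathsf{false})\bullet\mathsf{path}(\mathsf{true})$. Unfolding, the bicategory $\mathrm{AlgG}(\mathcal{T}^2)$ of algebras in groupoids has as objects groupoids $G$ (hom-types sets, not necessarily univalent) with an object $b$ and morphisms $l,r:b\to b$ such that $l\cdot r=r\cdot l$; 1-cells $(G,b,l,r)\to(G',b',l',r')$ are functors $F$ with an isomorphism $\varphi:F(b)\cong b'$ such that $F(l)\cdot\varphi=\varphi\cdot l'$ and $F(r)\cdot\varphi=\varphi\cdot r'$; 2-cells $(F,\varphi)\Rightarrow(F',\varphi')$ are natural transformations $\theta$ with $\theta_b\cdot\varphi'=\varphi$. An object of a bicategory is biinitial if for every object there is a 1-cell to it, any two such 1-cells are related by a 2-cell, and any two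 parallel such 2-cells are equal. -}

module Defs where

open import Level using (Level; _⊔_; 0ℓ) renaming (suc to lsuc)
open import Data.Unit using (⊤; tt)
open import Data.Product using (Σ; _×_; _,_; proj₁; proj₂)
open import Data.Product.Properties using (×-≡,≡→≡; ≡-dec)
open import Data.Integer using (ℤ; _+_; -_; 0ℤ; 1ℤ)
import Data.Integer.Properties as ℤP
open import Relation.Binary.PropositionalEquality using (_≡_; refl; cong₂)
open import Axiom.UniquenessOfIdentityProofs using (module Decidable⇒UIP)

-- Groupoids (hom-types are sets; no univalence requirement).
-- Composition is written in diagrammatic order: f · g is "f then g".

record Groupoid (o h : Level) : Set (lsuc (o ⊔ h)) where
  infixl 20 _·_
  field
    Obj     : Set o
    Hom     : Obj → Obj → Set h
    hom-set : ∀ {x y} {f g : Hom x y} (p q : f ≡ g) → p ≡ q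
    idm     : ∀ {x} → Hom x x
    _·_     : ∀ {x y z} → Hom x y → Hom y z → Hom x z
    inv     : ∀ {x y} → Hom x y → Hom y x
    idˡ     : ∀ {x y} (f : Hom x y) → idm · f ≡ f
    idʳ     : ∀ {x y} (f : Hom x y) → f · idm ≡ f
    assoc   : ∀ {w x y z} (f : Hom w x) (g : Hom x y) (k : Hom y z)
              → (f · g) · k ≡ f · (g · k)
    invˡ    : ∀ {x y} (f : Hom x y) → inv f · f ≡ idm
    invʳ    : ∀ {x y} (f : Hom x y) → f · inv f ≡ idm

open Groupoid

record Functor {o h o' h'} (G : Groupoid o h) (H : Groupoid o' h')
       : Set (o ⊔ h ⊔ o' ⊔ h') where
  field
    F₀    : Obj G → Obj H
    F₁    : ∀ {x y} → Hom G x y → Hom H (F₀ x) (F₀ y)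
    F-id  : ∀ {x} → F₁ (idm G {x}) ≡ idm H
    F-comp : ∀ {x y z} (f : Hom G x y) (g : Hom G y z)
             → F₁ (_·_ G f g) ≡ _·_ H (F₁ f) (F₁ g)

open Functor

record TorusAlg (o h : Level) : Set (lsuc (o ⊔ h)) where
  field
    G    : Groupoid o h
    b    : Obj G
    l    : Hom G b b
    r    : Hom G b b
    comm : _·_ G l r ≡ _·_ G r l

open TorusAlg

record AlgMor {o h o' h'} (X : TorusAlg o h) (Y : TorusAlg o' h')
       : Set (o ⊔ h ⊔ o' ⊔ h') where
  field
    F     : Functor (G X) (G Y)
    φ     : Hom (G Y) (F₀ F (b X)) (b Y)   -- an iso, automatically (groupoid)
    pres-l : _·_ (G Y) (F₁ F (l X)) φ ≡ _·_ (G Y) φ (l Y)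
    pres-r : _·_ (G Y) (F₁ F (r X)) φ ≡ _·_ (G Y) φ (r Y)

open AlgMor

record AlgCell {o h o' h'} {X : TorusAlg o h} {Y : TorusAlg o' h'}
       (f g : AlgMor X Y) : Set (o ⊔ h ⊔ h') where
  field
    θ   : ∀ x → Hom (G Y) (F₀ (F f) x) (F₀ (F g) x)
    nat : ∀ {x y} (k : Hom (G X) x y)
          → _·_ (G Y) (F₁ (F f) k) (θ y) ≡ _·_ (G Y) (θ x) (F₁ (F g) k)
    pt  : _·_ (G Y) (θ (b X)) (φ g) ≡ φ f

open AlgCell

-- Equality of 2-cells: equality of natural transformations, i.e. of their
-- components (the remaining fields are propositions since hom-types are sets).
_≋_ : ∀ {o h o' h'} {X : TorusAlg o h} {Y : TorusAlg o' h'} {f g : AlgMor X Y}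
      → AlgCell f g → AlgCell f g → Set (o ⊔ h')
α ≋ β = ∀ x → θ α x ≡ θ β x

Biinitial : TorusAlg 0ℓ 0ℓ → Set₁
Biinitial X =
  (Y : TorusAlg 0ℓ 0ℓ) →
    AlgMor X Y
  × ((f g : AlgMor X Y) → AlgCell f g)
  × ((f g : AlgMor X Y) (α β : AlgCell f g) → α ≋ β)

ℤ² : Set
ℤ² = ℤ × ℤ

_⊕_ : ℤ² → ℤ² → ℤ²
(a , b') ⊕ (c , d) = (a + c , b' + d)

ℤ²-uip : {p q : ℤ²} (e e' : p ≡ q) → e ≡ e'
ℤ²-uip = Decidable⇒UIP.≡-irrelevant (≡-dec ℤP._≟_ ℤP._≟_)

TorusGroupoid : Groupoid 0ℓ 0ℓ
TorusGroupoid = record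
  { Obj     = ⊤
  ; Hom     = λ _ _ → ℤ²
  ; hom-set = ℤ²-uip
  ; idm     = (0ℤ , 0ℤ)
  ; _·_     = _⊕_
  ; inv     = λ { (a , c) → (- a , - c) }
  ; idˡ     = λ { (a , c) → cong₂ _,_ (ℤP.+-identityˡ a) (ℤP.+-identityˡ c) }
  ; idʳ     = λ { (a , c) → cong₂ _,_ (ℤP.+-identityʳ a) (ℤP.+-identityʳ c) }
  ; assoc   = λ { (a , c) (a' , c') (a'' , c'') →
                  cong₂ _,_ (ℤP.+-assoc a a' a'') (ℤP.+-assoc c c' c'') }
  ; invˡ    = λ { (a , c) → cong₂ _,_ (ℤP.+-inverseˡ a) (ℤP.+-inverseˡ c) }
  ; invʳ    = λ { (a , c) → cong₂ _,_ (ℤP.+-inverseʳ a) (ℤP.+-inverseʳ c) }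
  }

TorusAlgebra : TorusAlg 0ℓ 0ℓ
TorusAlgebra = record
  { G    = TorusGroupoid
  ; b    = tt
  ; l    = (1ℤ , 0ℤ)
  ; r    = (0ℤ , 1ℤ)
  ; comm = refl
  }

-- The torus groupoid is freely generated by two commuting loops: every
-- morphism (m , n) is l^m · r^n. Hence any 1-cell f into Y sends (m , n) to
-- l^m · r^n conjugated by its point isomorphism φ_f. Since there is only one
-- object, the constant family φ_f · φ_g⁻¹ is a 2-cell f ⇒ g, and the point
-- condition forces every 2-cell to be this one. A 1-cell exists because
-- (m , n) ↦ l^m · r^n is a functor, l and r commuting.
module Submission where

open import Data.Unit using (tt)
open import Data.Nat using (ℕ; zero; suc)
open import Data.Product using (_,_)
open import Data.Integer using (ℤ; +_; -[1+_]; _+_; 0ℤ; 1ℤ; -1ℤ)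
import Data.Integer.Properties as ℤ
open import Relation.Binary.PropositionalEquality
open import Defs

open Functor
open TorusAlg
open AlgMor
open AlgCell

module GroupoidProperties {o h} (H : Groupoid o h) where
  open Groupoid H
  open ≡-Reasoning

  ·-cancelʳ : ∀ {a b c} {p q : Hom a b} (φ : Hom b c) → p · φ ≡ q · φ → p ≡ q
  ·-cancelʳ {p = p} {q} φ e = begin
    p                 ≡⟨ sym (idʳ p) ⟩
    p · idm           ≡⟨ cong (p ·_) (sym (invʳ φ)) ⟩
    p · (φ · inv φ)   ≡⟨ sym (assoc p φ (inv φ)) ⟩
    (p · φ) · inv φ   ≡⟨ cong (_· inv φ) e ⟩
    (q · φ) · inv φ   ≡⟨ assoc q φ (inv φ) ⟩
    q · (φ · inv φ)   ≡⟨ cong (q ·_) (invʳ φ) ⟩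
    q · idm           ≡⟨ idʳ q ⟩
    q                 ∎

  inverseˡ-unique : ∀ {a b} {p : Hom a b} {q : Hom b a} → p · q ≡ idm → p ≡ inv q
  inverseˡ-unique {q = q} e = ·-cancelʳ q (trans e (sym (invˡ q)))

  ·-inv-cancelˡ : ∀ {a b c} (x : Hom a b) (y : Hom a c) → x · (inv x · y) ≡ y
  ·-inv-cancelˡ x y = trans (sym (assoc x (inv x) y)) (trans (cong (_· y) (invʳ x)) (idˡ y))

  inv-·-cancelˡ : ∀ {a b c} (x : Hom a b) (y : Hom b c) → inv x · (x · y) ≡ y
  inv-·-cancelˡ x y = trans (sym (assoc (inv x) x y)) (trans (cong (_· y) (invˡ x)) (idˡ y))

  ·-inv-cancelʳ : ∀ {a b c} (x : Hom a b) (y : Hom c b) → (x · inv y) · y ≡ x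
  ·-inv-cancelʳ x y = trans (assoc x (inv y) y) (trans (cong (x ·_) (invˡ y)) (idʳ x))

  Intertwines : ∀ {a b} → Hom a b → Hom a a → Hom b b → Set h
  Intertwines φ x y = x · φ ≡ φ · y

  intertwines-idm : ∀ {a b} (φ : Hom a b) → Intertwines φ idm idm
  intertwines-idm φ = trans (idˡ φ) (sym (idʳ φ))

  ≡⇒intertwines-idm : ∀ {a} {x y : Hom a a} → x ≡ y → Intertwines idm x y
  ≡⇒intertwines-idm {x = x} {y} e = trans (idʳ x) (trans e (sym (idˡ y)))

  intertwines-· : ∀ {a b} {φ : Hom a b} {x x' y y'} →
                  Intertwines φ x y → Intertwines φ x' y' → Intertwines φ (x · x') (y · y')
  intertwines-· {φ = φ} {x} {x'} {y} {y'} e e' = begin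
    (x · x') · φ  ≡⟨ assoc x x' φ ⟩
    x · (x' · φ)  ≡⟨ cong (x ·_) e' ⟩
    x · (φ · y')  ≡⟨ sym (assoc x φ y') ⟩
    (x · φ) · y'  ≡⟨ cong (_· y') e ⟩
    (φ · y) · y'  ≡⟨ assoc φ y y' ⟩
    φ · (y · y')  ∎

  intertwines-trans : ∀ {a b c} {φ : Hom a b} {ψ : Hom b c} {x y z} →
                      Intertwines φ x y → Intertwines ψ y z → Intertwines (φ · ψ) x z
  intertwines-trans {φ = φ} {ψ} {x} {y} {z} e e' = begin
    x · (φ · ψ)  ≡⟨ sym (assoc x φ ψ) ⟩
    (x · φ) · ψ  ≡⟨ cong (_· ψ) e ⟩
    (φ · y) · ψ  ≡⟨ assoc φ y ψ ⟩
    φ · (y · ψ)  ≡⟨ cong (φ ·_) e' ⟩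
    φ · (ψ · z)  ≡⟨ sym (assoc φ ψ z) ⟩
    (φ · ψ) · z  ∎

  intertwines-sym : ∀ {a b} {φ : Hom a b} {x y} → Intertwines φ x y → Intertwines (inv φ) y x
  intertwines-sym {φ = φ} {x} {y} e = ·-cancelʳ φ (begin
    (y · inv φ) · φ  ≡⟨ ·-inv-cancelʳ y φ ⟩
    y                ≡⟨ sym (inv-·-cancelˡ φ y) ⟩
    inv φ · (φ · y)  ≡⟨ cong (inv φ ·_) (sym e) ⟩
    inv φ · (x · φ)  ≡⟨ sym (assoc (inv φ) x φ) ⟩
    (inv φ · x) · φ  ∎)

  intertwines-inv : ∀ {a b} {φ : Hom a b} {x y} → Intertwines φ x y → Intertwines φ (inv x) (inv y)
  intertwines-inv {φ = φ} {x} {y} e = ·-cancelʳ y (begin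
    (inv x · φ) · y  ≡⟨ assoc (inv x) φ y ⟩
    inv x · (φ · y)  ≡⟨ cong (inv x ·_) (sym e) ⟩
    inv x · (x · φ)  ≡⟨ inv-·-cancelˡ x φ ⟩
    φ                ≡⟨ sym (·-inv-cancelʳ φ y) ⟩
    (φ · inv y) · y  ∎)

  pow⁺ : ∀ {a} → Hom a a → ℕ → Hom a a
  pow⁺ x zero    = idm
  pow⁺ x (suc n) = x · pow⁺ x n

  pow : ∀ {a} → Hom a a → ℤ → Hom a a
  pow x (+ n)    = pow⁺ x n
  pow x -[1+ n ] = pow⁺ (inv x) (suc n)

  pow-suc : ∀ {a} (x : Hom a a) m → pow x (1ℤ + m) ≡ x · pow x m
  pow-suc x (+ n)          = refl
  pow-suc x -[1+ zero ]    = sym (trans (cong (x ·_) (idʳ (inv x))) (invʳ x))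
  pow-suc x -[1+ suc n ]   = sym (·-inv-cancelˡ x _)

  pow-pred : ∀ {a} (x : Hom a a) m → pow x (-1ℤ + m) ≡ inv x · pow x m
  pow-pred x (+ zero)  = refl
  pow-pred x (+ suc n) = sym (inv-·-cancelˡ x _)
  pow-pred x -[1+ n ]  = refl

  pow-+ : ∀ {a} (x : Hom a a) m n → pow x (m + n) ≡ pow x m · pow x n
  pow-+ x (+ zero) n = trans (cong (pow x) (ℤ.+-identityˡ n)) (sym (idˡ (pow x n)))
  pow-+ x (+ suc k) n = begin
    pow x (1ℤ + + k + n)          ≡⟨ cong (pow x) (ℤ.+-assoc 1ℤ (+ k) n) ⟩
    pow x (1ℤ + (+ k + n))        ≡⟨ pow-suc x (+ k + n) ⟩
    x · pow x (+ k + n)           ≡⟨ cong (x ·_) (pow-+ x (+ k) n) ⟩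
    x · (pow x (+ k) · pow x n)   ≡⟨ sym (assoc x (pow x (+ k)) (pow x n)) ⟩
    (x · pow x (+ k)) · pow x n   ∎
  pow-+ x -[1+ zero ] n = begin
    pow x (-1ℤ + n)               ≡⟨ pow-pred x n ⟩
    inv x · pow x n               ≡⟨ cong (_· pow x n) (sym (idʳ (inv x))) ⟩
    (inv x · idm) · pow x n       ∎
  pow-+ x -[1+ suc k ] n = begin
    pow x (-1ℤ + -[1+ k ] + n)            ≡⟨ cong (pow x) (ℤ.+-assoc -1ℤ -[1+ k ] n) ⟩
    pow x (-1ℤ + (-[1+ k ] + n))          ≡⟨ pow-pred x (-[1+ k ] + n) ⟩
    inv x · pow x (-[1+ k ] + n)          ≡⟨ cong (inv x ·_) (pow-+ x -[1+ k ] n) ⟩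
    inv x · (pow x -[1+ k ] · pow x n)    ≡⟨ sym (assoc (inv x) (pow x -[1+ k ]) (pow x n)) ⟩
    (inv x · pow x -[1+ k ]) · pow x n    ∎

  intertwines-pow⁺ : ∀ {a b} {φ : Hom a b} {x y} → Intertwines φ x y → ∀ n → Intertwines φ (pow⁺ x n) (pow⁺ y n)
  intertwines-pow⁺ e zero    = intertwines-idm _
  intertwines-pow⁺ e (suc n) = intertwines-· e (intertwines-pow⁺ e n)

  intertwines-pow : ∀ {a b} {φ : Hom a b} {x y} → Intertwines φ x y → ∀ m → Intertwines φ (pow x m) (pow y m)
  intertwines-pow e (+ n)    = intertwines-pow⁺ e n
  intertwines-pow e -[1+ n ] = intertwines-pow⁺ (intertwines-inv e) (suc n)

  -- x · y ≡ y · x says that y intertwines x with itself.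
  pow-comm : ∀ {a} {x y : Hom a a} → x · y ≡ y · x → ∀ m n → pow x m · pow y n ≡ pow y n · pow x m
  pow-comm e m n = sym (intertwines-pow (sym (intertwines-pow e m)) n)

module FunctorProperties {o h o' h'} {G₁ : Groupoid o h} {H : Groupoid o' h'} (F : Functor G₁ H) where
  open Groupoid
  module G₁ = GroupoidProperties G₁
  module H = GroupoidProperties H

  F-inv : ∀ {a b} (x : Hom G₁ a b) → F₁ F (inv G₁ x) ≡ inv H (F₁ F x)
  F-inv x = H.inverseˡ-unique (trans (sym (F-comp F _ x)) (trans (cong (F₁ F) (invˡ G₁ x)) (F-id F)))

  F-pow⁺ : ∀ {a} (x : Hom G₁ a a) n → F₁ F (G₁.pow⁺ x n) ≡ H.pow⁺ (F₁ F x) n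
  F-pow⁺ x zero    = F-id F
  F-pow⁺ x (suc n) = trans (F-comp F x _) (cong (_·_ H (F₁ F x)) (F-pow⁺ x n))

  F-pow : ∀ {a} (x : Hom G₁ a a) m → F₁ F (G₁.pow x m) ≡ H.pow (F₁ F x) m
  F-pow x (+ n)    = F-pow⁺ x n
  F-pow x -[1+ n ] = trans (F-pow⁺ (inv G₁ x) (suc n)) (cong (λ y → H.pow⁺ y (suc n)) (F-inv x))

e₁ e₂ : ℤ²
e₁ = 1ℤ , 0ℤ
e₂ = 0ℤ , 1ℤ

module Torus = GroupoidProperties TorusGroupoid

pow⁺-e₁ : ∀ n → Torus.pow⁺ e₁ n ≡ (+ n , 0ℤ)
pow⁺-e₁ zero    = refl
pow⁺-e₁ (suc n) = cong (e₁ ⊕_) (pow⁺-e₁ n)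

pow⁺-e₂ : ∀ n → Torus.pow⁺ e₂ n ≡ (0ℤ , + n)
pow⁺-e₂ zero    = refl
pow⁺-e₂ (suc n) = cong (e₂ ⊕_) (pow⁺-e₂ n)

pow⁺-e₁⁻¹ : ∀ n → Torus.pow⁺ (-1ℤ , 0ℤ) (suc n) ≡ (-[1+ n ] , 0ℤ)
pow⁺-e₁⁻¹ zero    = refl
pow⁺-e₁⁻¹ (suc n) = cong ((-1ℤ , 0ℤ) ⊕_) (pow⁺-e₁⁻¹ n)

pow⁺-e₂⁻¹ : ∀ n → Torus.pow⁺ (0ℤ , -1ℤ) (suc n) ≡ (0ℤ , -[1+ n ])
pow⁺-e₂⁻¹ zero    = refl
pow⁺-e₂⁻¹ (suc n) = cong ((0ℤ , -1ℤ) ⊕_) (pow⁺-e₂⁻¹ n)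

pow-e₁ : ∀ m → Torus.pow e₁ m ≡ (m , 0ℤ)
pow-e₁ (+ n)    = pow⁺-e₁ n
pow-e₁ -[1+ n ] = pow⁺-e₁⁻¹ n

pow-e₂ : ∀ m → Torus.pow e₂ m ≡ (0ℤ , m)
pow-e₂ (+ n)    = pow⁺-e₂ n
pow-e₂ -[1+ n ] = pow⁺-e₂⁻¹ n

ℤ²-generated : ∀ m n → (m , n) ≡ Torus.pow e₁ m ⊕ Torus.pow e₂ n
ℤ²-generated m n = sym (trans (cong₂ _⊕_ (pow-e₁ m) (pow-e₂ n))
                              (cong₂ _,_ (ℤ.+-identityʳ m) (ℤ.+-identityˡ n)))

module _ {o h} {H : Groupoid o h} (F : Functor TorusGroupoid H) where
  open Groupoid H
  open GroupoidProperties H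
  open ≡-Reasoning

  F₁-generated : ∀ m n → F₁ F (m , n) ≡ pow (F₁ F e₁) m · pow (F₁ F e₂) n
  F₁-generated m n = begin
    F₁ F (m , n)                                         ≡⟨ cong (F₁ F) (ℤ²-generated m n) ⟩
    F₁ F (Torus.pow e₁ m ⊕ Torus.pow e₂ n)               ≡⟨ F-comp F (Torus.pow e₁ m) (Torus.pow e₂ n) ⟩
    F₁ F (Torus.pow e₁ m) · F₁ F (Torus.pow e₂ n)        ≡⟨ cong₂ _·_ (FunctorProperties.F-pow F e₁ m)
                                                                      (FunctorProperties.F-pow F e₂ n) ⟩
    pow (F₁ F e₁) m · pow (F₁ F e₂) n                    ∎

module _ {o h} (Y : TorusAlg o h) where
  open Groupoid (G Y)
  open GroupoidProperties (G Y)
  open ≡-Reasoning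

  interpret : ℤ² → Hom (b Y) (b Y)
  interpret (m , n) = pow (l Y) m · pow (r Y) n

  interpret-⊕ : ∀ k k' → interpret (k ⊕ k') ≡ interpret k · interpret k'
  interpret-⊕ (m , n) (m' , n') = begin
    pow (l Y) (m + m') · pow (r Y) (n + n')   ≡⟨ cong₂ _·_ (pow-+ (l Y) m m') (pow-+ (r Y) n n') ⟩
    (lᵐ · lᵐ') · (rⁿ · rⁿ')                   ≡⟨ assoc lᵐ lᵐ' (rⁿ · rⁿ') ⟩
    lᵐ · (lᵐ' · (rⁿ · rⁿ'))                   ≡⟨ cong (lᵐ ·_) (sym (assoc lᵐ' rⁿ rⁿ')) ⟩
    lᵐ · ((lᵐ' · rⁿ) · rⁿ')                   ≡⟨ cong (λ z → lᵐ · (z · rⁿ')) (pow-comm (comm Y) m' n) ⟩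
    lᵐ · ((rⁿ · lᵐ') · rⁿ')                   ≡⟨ cong (lᵐ ·_) (assoc rⁿ lᵐ' rⁿ') ⟩
    lᵐ · (rⁿ · (lᵐ' · rⁿ'))                   ≡⟨ sym (assoc lᵐ rⁿ (lᵐ' · rⁿ')) ⟩
    (lᵐ · rⁿ) · (lᵐ' · rⁿ')                   ∎
    where
      lᵐ = pow (l Y) m
      lᵐ' = pow (l Y) m'
      rⁿ = pow (r Y) n
      rⁿ' = pow (r Y) n'

  recursor : AlgMor TorusAlgebra Y
  recursor = record
    { F      = record
      { F₀     = λ _ → b Y
      ; F₁     = interpret
      ; F-id   = idˡ idm
      ; F-comp = interpret-⊕
      }
    ; φ      = idm
    ; pres-l = ≡⇒intertwines-idm (trans (idʳ _) (idʳ (l Y)))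
    ; pres-r = ≡⇒intertwines-idm (trans (idˡ _) (idʳ (r Y)))
    }

  φ-intertwines : (f : AlgMor TorusAlgebra Y) (k : ℤ²) → Intertwines (φ f) (F₁ (F f) k) (interpret k)
  φ-intertwines f (m , n) =
    subst (λ x → Intertwines (φ f) x (interpret (m , n)))
          (sym (F₁-generated (F f) m n))
          (intertwines-· (intertwines-pow (pres-l f) m) (intertwines-pow (pres-r f) n))

  cell : (f g : AlgMor TorusAlgebra Y) → AlgCell f g
  cell f g = record
    { θ   = λ _ → φ f · inv (φ g)
    ; nat = λ k → intertwines-trans (φ-intertwines f k) (intertwines-sym (φ-intertwines g k))
    ; pt  = ·-inv-cancelʳ (φ f) (φ g)
    }

  cell-unique : (f g : AlgMor TorusAlgebra Y) (α β : AlgCell f g) → α ≋ β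
  cell-unique f g α β tt = ·-cancelʳ (φ g) (trans (pt α) (sym (pt β)))

proposition11p10 : Biinitial TorusAlgebra
proposition11p10 Y = recursor Y , cell Y , cell-unique Y
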